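{- Let $A,A_1,\dots,A_n$ be coherent quantales. The following are equivalent: (1) $A$ is isomorphic to $\prod_{i=1}^n A_i$; (2) there exist $e_1,\dots,e_n\in B(A)$ such that $\bigwedge_{i=1}^n e_i=0$, $e_i\vee e_j=1$ for all $i\neq j$, and $A_i$ is isomorphic to $[e_i)_A$ for every $i\in\{1,\dots,n\}$.
   Context: A quantale is a complete lattice $(A,\vee,\wedge,0,1)$ with an associative, commutative multiplication $\cdot$ with unit $1$ distributing over arbitrary joins. $K(A)$ is the set of compact elements; $A$ is coherent if every element is a join of compact elements, $1\in K(A)$ and $K(A)$ is closed under $\cdot$. $B(A)$ is the Boolean algebra of complemented elements. For $b\in A$, $[b)_A=\{x\in A:b\le x\}$ is a quantale with the lattice operations of $A$, bottom $b$, top $1$, multiplication $x\cdot_b y=(x\cdot y)\vee b$. Products carry the componentwise operations; isomorphisms are quantale isomorphisms. -}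

module Defs where

open import Level using (0ℓ)
open import Data.Bool using (Bool; true; false)
open import Data.Empty using (⊥)
open import Data.Nat using (ℕ; zero; suc)
open import Data.Fin using (Fin)
open import Data.List using (List; []; _∷_; map)
open import Data.Product using (Σ; Σ-syntax; _×_; _,_; proj₁; proj₂)
open import Function.Base using (_∘_; _on_)
open import Relation.Binary.Core using (Rel)
open import Relation.Binary.Structures using (IsPartialOrder; IsEquivalence)
open import Algebra.Structures using (IsCommutativeMonoid)
import Relation.Binary.Construct.On as On

-- Commutative, integral quantales (top element = multiplicative unit 1),
-- carried by a setoid.  Arbitrary joins are joins of families indexed by
-- any type I : Set.

record Quantale : Set₁ where
  infix 4 _≈_ _≤_
  infixr 7 _·_
  infixr 6 _∧_
  field
    Carrier        : Set
    _≈_            : Rel Carrier 0ℓ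
    _≤_            : Rel Carrier 0ℓ
    isPartialOrder : IsPartialOrder _≈_ _≤_
    ⋁              : {I : Set} → (I → Carrier) → Carrier
    ⋁-upper        : ∀ {I : Set} (f : I → Carrier) (i : I) → f i ≤ ⋁ f
    ⋁-least        : ∀ {I : Set} (f : I → Carrier) (x : Carrier) →
                     (∀ i → f i ≤ x) → ⋁ f ≤ x
    _∧_            : Carrier → Carrier → Carrier
    ∧-lowerˡ       : ∀ x y → x ∧ y ≤ x
    ∧-lowerʳ       : ∀ x y → x ∧ y ≤ y
    ∧-greatest     : ∀ {x y z} → z ≤ x → z ≤ y → z ≤ x ∧ y
    _·_            : Carrier → Carrier → Carrier
    1#             : Carrier
    ·-isCommutativeMonoid : IsCommutativeMonoid _≈_ _·_ 1#
    ·-distrib-⋁    : ∀ x {I : Set} (f : I → Carrier) → x · ⋁ f ≈ ⋁ (λ i → x · f i)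
    ≤-top          : ∀ x → x ≤ 1#

  pair : Carrier → Carrier → Bool → Carrier
  pair a b true  = a
  pair a b false = b

  infixr 5 _∨_
  _∨_ : Carrier → Carrier → Carrier
  a ∨ b = ⋁ (pair a b)

  0# : Carrier
  0# = ⋁ {⊥} (λ ())

  ⋁-list : List Carrier → Carrier
  ⋁-list []       = 0#
  ⋁-list (x ∷ xs) = x ∨ ⋁-list xs

  ⋀-fin : ∀ {n} → (Fin n → Carrier) → Carrier
  ⋀-fin {zero}  e = 1#
  ⋀-fin {suc n} e = e Fin.zero ∧ ⋀-fin (λ i → e (Fin.suc i))

  IsCompact : Carrier → Set₁
  IsCompact c = ∀ {I : Set} (f : I → Carrier) → c ≤ ⋁ f →
                Σ[ is ∈ List I ] c ≤ ⋁-list (map f is)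

  IsCoherent : Set₁
  IsCoherent =
    (∀ x → Σ[ I ∈ Set ] Σ[ f ∈ (I → Carrier) ] ((∀ i → IsCompact (f i)) × x ≈ ⋁ f))
    × IsCompact 1#
    × (∀ c d → IsCompact c → IsCompact d → IsCompact (c · d))

  IsComplemented : Carrier → Set
  IsComplemented x = Σ[ y ∈ Carrier ] (x ∨ y ≈ 1# × x ∧ y ≈ 0#)


record _≅_ (A B : Quantale) : Set₁ where
  private
    module A = Quantale A
    module B = Quantale B
  field
    to       : A.Carrier → B.Carrier
    from     : B.Carrier → A.Carrier
    to-cong  : ∀ {x y} → x A.≈ y → to x B.≈ to y
    from-cong : ∀ {x y} → x B.≈ y → from x A.≈ from y
    from-to  : ∀ x → from (to x) A.≈ x
    to-from  : ∀ y → to (from y) B.≈ y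
    to-⋁     : ∀ {I : Set} (f : I → A.Carrier) → to (A.⋁ f) B.≈ B.⋁ (to ∘ f)
    to-·     : ∀ x y → to (x A.· y) B.≈ (to x B.· to y)
    to-1     : to A.1# B.≈ B.1#

module QProps (Q : Quantale) where
  open Quantale Q
  module PO = IsPartialOrder isPartialOrder
  module M = IsCommutativeMonoid ·-isCommutativeMonoid

  ≤-refl : ∀ {x} → x ≤ x
  ≤-refl = PO.refl
  ≤-trans : ∀ {x y z} → x ≤ y → y ≤ z → x ≤ z
  ≤-trans = PO.trans
  ≈⇒≤ : ∀ {x y} → x ≈ y → x ≤ y
  ≈⇒≤ = PO.reflexive
  antisym : ∀ {x y} → x ≤ y → y ≤ x → x ≈ y
  antisym = PO.antisym
  ≈-refl : ∀ {x} → x ≈ x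
  ≈-refl = PO.Eq.refl
  ≈-sym : ∀ {x y} → x ≈ y → y ≈ x
  ≈-sym = PO.Eq.sym
  ≈-trans : ∀ {x y z} → x ≈ y → y ≈ z → x ≈ z
  ≈-trans = PO.Eq.trans

  ⋁-mono : ∀ {I : Set} (f g : I → Carrier) → (∀ i → f i ≤ g i) → ⋁ f ≤ ⋁ g
  ⋁-mono f g h = ⋁-least f (⋁ g) (λ i → ≤-trans (h i) (⋁-upper g i))

  ⋁-cong : ∀ {I : Set} (f g : I → Carrier) → (∀ i → f i ≈ g i) → ⋁ f ≈ ⋁ g
  ⋁-cong f g h = antisym (⋁-mono f g (λ i → ≈⇒≤ (h i)))
                         (⋁-mono g f (λ i → ≈⇒≤ (≈-sym (h i))))

  ∨-ub₁ : ∀ a b → a ≤ a ∨ b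
  ∨-ub₁ a b = ⋁-upper (pair a b) true
  ∨-ub₂ : ∀ a b → b ≤ a ∨ b
  ∨-ub₂ a b = ⋁-upper (pair a b) false
  ∨-least : ∀ {a b c} → a ≤ c → b ≤ c → a ∨ b ≤ c
  ∨-least {a} {b} {c} p q = ⋁-least (pair a b) c λ { true → p ; false → q }
  ∨-cong : ∀ {a a' b b'} → a ≈ a' → b ≈ b' → a ∨ b ≈ a' ∨ b'
  ∨-cong {a} {a'} {b} {b'} p q =
    ⋁-cong (pair a b) (pair a' b') λ { true → p ; false → q }
  absorbˡ : ∀ {a b} → b ≤ a → a ∨ b ≈ a
  absorbˡ {a} {b} p = antisym (∨-least ≤-refl p) (∨-ub₁ a b)
  absorbʳ : ∀ {a b} → a ≤ b → a ∨ b ≈ b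
  absorbʳ {a} {b} p = antisym (∨-least p ≤-refl) (∨-ub₂ a b)

  ·-cong : ∀ {x x' y y'} → x ≈ x' → y ≈ y' → x · y ≈ x' · y'
  ·-cong = M.∙-cong

  distribˡ-∨ : ∀ x a b → x · (a ∨ b) ≈ x · a ∨ x · b
  distribˡ-∨ x a b = ≈-trans (·-distrib-⋁ x (pair a b))
    (⋁-cong _ (pair (x · a) (x · b)) λ { true → ≈-refl ; false → ≈-refl })

  distribʳ-∨ : ∀ x a b → (a ∨ b) · x ≈ a · x ∨ b · x
  distribʳ-∨ x a b = ≈-trans (M.comm (a ∨ b) x)
    (≈-trans (distribˡ-∨ x a b) (∨-cong (M.comm x a) (M.comm x b)))

  ·-monoʳ : ∀ x {a b} → a ≤ b → x · a ≤ x · b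
  ·-monoʳ x {a} {b} p = ≤-trans (∨-ub₁ (x · a) (x · b))
    (≈⇒≤ (≈-trans (≈-sym (distribˡ-∨ x a b)) (·-cong ≈-refl (absorbʳ p))))

  ·-monoˡ : ∀ x {a b} → a ≤ b → a · x ≤ b · x
  ·-monoˡ x {a} {b} p = ≤-trans (≈⇒≤ (M.comm a x))
    (≤-trans (·-monoʳ x p) (≈⇒≤ (M.comm x b)))

  ·-≤ˡ : ∀ x y → x · y ≤ x
  ·-≤ˡ x y = ≤-trans (·-monoʳ x (≤-top y)) (≈⇒≤ (M.identityʳ x))

Π : ∀ {n} → (Fin n → Quantale) → Quantale
Π {n} A = record
  { Carrier = (i : Fin n) → Quantale.Carrier (A i)
  ; _≈_ = λ x y → ∀ i → Quantale._≈_ (A i) (x i) (y i)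
  ; _≤_ = λ x y → ∀ i → Quantale._≤_ (A i) (x i) (y i)
  ; isPartialOrder = record
    { isPreorder = record
      { isEquivalence = record
        { refl = λ i → P.≈-refl i
        ; sym = λ p i → P.≈-sym i (p i)
        ; trans = λ p q i → P.≈-trans i (p i) (q i) }
      ; reflexive = λ p i → P.≈⇒≤ i (p i)
      ; trans = λ p q i → P.≤-trans i (p i) (q i) }
    ; antisym = λ p q i → P.antisym i (p i) (q i) }
  ; ⋁ = λ f i → Quantale.⋁ (A i) (λ j → f j i)
  ; ⋁-upper = λ f j i → Quantale.⋁-upper (A i) (λ k → f k i) j
  ; ⋁-least = λ f x h i → Quantale.⋁-least (A i) (λ k → f k i) (x i) (λ k → h k i)
  ; _∧_ = λ x y i → Quantale._∧_ (A i) (x i) (y i)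
  ; ∧-lowerˡ = λ x y i → Quantale.∧-lowerˡ (A i) (x i) (y i)
  ; ∧-lowerʳ = λ x y i → Quantale.∧-lowerʳ (A i) (x i) (y i)
  ; ∧-greatest = λ p q i → Quantale.∧-greatest (A i) (p i) (q i)
  ; _·_ = λ x y i → Quantale._·_ (A i) (x i) (y i)
  ; 1# = λ i → Quantale.1# (A i)
  ; ·-isCommutativeMonoid = record
    { isMonoid = record
      { isSemigroup = record
        { isMagma = record
          { isEquivalence = record
            { refl = λ i → P.≈-refl i
            ; sym = λ p i → P.≈-sym i (p i)
            ; trans = λ p q i → P.≈-trans i (p i) (q i) }
          ; ∙-cong = λ p q i → P.·-cong i (p i) (q i) }
        ; assoc = λ x y z i → P.M.assoc i (x i) (y i) (z i) }
      ; identity = (λ x i → P.M.identityˡ i (x i)) , (λ x i → P.M.identityʳ i (x i)) }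
    ; comm = λ x y i → P.M.comm i (x i) (y i) }
  ; ·-distrib-⋁ = λ x f i → Quantale.·-distrib-⋁ (A i) (x i) (λ j → f j i)
  ; ≤-top = λ x i → Quantale.≤-top (A i) (x i)
  }
  where module P (i : Fin n) = QProps (A i)

-- The quantale [b)_A = { x ∈ A | b ≤ x }: lattice operations of A
-- (the join of a family is b ∨ its join in A, so the empty join is b),
-- bottom b, top 1, multiplication x ·_b y = (x · y) ∨ b.

[_⟩ : {A : Quantale} → Quantale.Carrier A → Quantale
[_⟩ {A} b = record
  { Carrier = Σ[ x ∈ Quantale.Carrier A ] Quantale._≤_ A b x
  ; _≈_ = _≈_ on proj₁
  ; _≤_ = _≤_ on proj₁
  ; isPartialOrder = On.isPartialOrder proj₁ isPartialOrder
  ; ⋁ = ⋁'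
  ; ⋁-upper = λ f i → ≤-trans (⋁-upper (proj₁ ∘ f) i) (∨-ub₂ b _)
  ; ⋁-least = λ f x h → ∨-least (proj₂ x) (⋁-least (proj₁ ∘ f) (proj₁ x) h)
  ; _∧_ = λ x y → (proj₁ x ∧ proj₁ y) , ∧-greatest (proj₂ x) (proj₂ y)
  ; ∧-lowerˡ = λ x y → ∧-lowerˡ (proj₁ x) (proj₁ y)
  ; ∧-lowerʳ = λ x y → ∧-lowerʳ (proj₁ x) (proj₁ y)
  ; ∧-greatest = ∧-greatest
  ; _·_ = _·'_
  ; 1# = 1# , ≤-top b
  ; ·-isCommutativeMonoid = record
    { isMonoid = record
      { isSemigroup = record
        { isMagma = record
          { isEquivalence = record { refl = ≈-refl ; sym = ≈-sym ; trans = ≈-trans }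
          ; ∙-cong = λ p q → ∨-cong (·-cong p q) ≈-refl }
        ; assoc = assoc' }
      ; identity = idˡ , (λ x → ≈-trans (∨-cong (M.comm (proj₁ x) 1#) ≈-refl) (idˡ x)) }
    ; comm = λ x y → ∨-cong (M.comm (proj₁ x) (proj₁ y)) ≈-refl }
  ; ·-distrib-⋁ = distrib'
  ; ≤-top = λ x → ≤-top (proj₁ x)
  }
  where
  open Quantale A
  open QProps A
  C' = Σ[ x ∈ Carrier ] b ≤ x

  ⋁' : {I : Set} → (I → C') → C'
  ⋁' f = (b ∨ ⋁ (proj₁ ∘ f)) , ∨-ub₁ b _

  _·'_ : C' → C' → C'
  x ·' y = (proj₁ x · proj₁ y ∨ b) , ∨-ub₂ _ b

  L : ∀ u z → (u ∨ b) · z ∨ b ≈ u · z ∨ b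
  L u z = antisym
    (∨-least (≤-trans (≈⇒≤ (distribʳ-∨ z u b))
                      (∨-least (∨-ub₁ _ b) (≤-trans (·-≤ˡ b z) (∨-ub₂ _ b))))
             (∨-ub₂ _ b))
    (∨-least (≤-trans (·-monoˡ z (∨-ub₁ u b)) (∨-ub₁ _ b)) (∨-ub₂ _ b))

  assoc' : ∀ x y z → proj₁ ((x ·' y) ·' z) ≈ proj₁ (x ·' (y ·' z))
  assoc' (x , _) (y , _) (z , _) =
    ≈-trans (L (x · y) z)
    (≈-trans (∨-cong (M.assoc x y z) ≈-refl)
    (≈-trans (∨-cong (M.comm x (y · z)) ≈-refl)
    (≈-trans (≈-sym (L (y · z) x))
             (∨-cong (M.comm (y · z ∨ b) x) ≈-refl))))

  idˡ : ∀ x → proj₁ ((1# , ≤-top b) ·' x) ≈ proj₁ x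
  idˡ (x , p) = ≈-trans (∨-cong (M.identityˡ x) ≈-refl) (absorbˡ p)

  distrib' : ∀ x {I : Set} (f : I → C') →
             proj₁ (x ·' ⋁' f) ≈ proj₁ (⋁' (λ i → x ·' f i))
  distrib' (x , _) f = antisym
    (∨-least
      (≤-trans (≈⇒≤ (distribˡ-∨ x b (⋁ (proj₁ ∘ f))))
        (∨-least (≤-trans (≤-trans (≈⇒≤ (M.comm x b)) (·-≤ˡ b x)) (∨-ub₁ b _))
                 (≤-trans (≈⇒≤ (·-distrib-⋁ x (proj₁ ∘ f)))
                   (≤-trans (⋁-mono _ _ (λ i → ∨-ub₁ _ b)) (∨-ub₂ b _)))))
      (∨-ub₁ b _))
    (∨-least (∨-ub₂ _ b)
      (⋁-least _ _ λ i →
        ∨-least (≤-trans (·-monoʳ x (≤-trans (⋁-upper (proj₁ ∘ f) i)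
                                             (∨-ub₂ b (⋁ (proj₁ ∘ f)))))
                         (∨-ub₁ _ b))
                (∨-ub₂ _ b)))

-- Joining with a complemented element e (complement e′) distributes over finite meets,
-- since every z splits as z · e ∨ z · e′.  Hence for complemented, pairwise comaximal
-- e₁ … eₙ with ⋀ eᵢ = 0 the map x ↦ (x ∨ eᵢ)ᵢ is an isomorphism A ≅ Π [eᵢ⟩ with inverse
-- y ↦ ⋀ yᵢ.  Conversely, in Π Aᵢ the elements that are 0 in coordinate i and 1 elsewhere
-- form such a family with [eᵢ⟩ ≅ Aᵢ, and the conditions transfer along isomorphisms.

module Submission where

open import Defs
open import Data.Nat using (ℕ; zero; suc)
open import Data.Fin using (Fin; zero; suc)
open import Data.Fin.Properties using (_≟_)
open import Data.Bool using (true; false)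
open import Data.Empty using (⊥-elim)
open import Data.Product using (Σ-syntax; _×_; _,_; proj₁; proj₂)
open import Relation.Binary.PropositionalEquality using (_≢_; refl; sym)
open import Relation.Nullary using (yes; no)
open import Function.Base using (_∘_)
open import Function.Bundles using (_⇔_; mk⇔)

module QuantaleProperties (Q : Quantale) where
  open Quantale Q
  open QProps Q public

  0-least : ∀ x → 0# ≤ x
  0-least x = ⋁-least (λ ()) x (λ ())

  ∨-identityˡ : ∀ x → 0# ∨ x ≈ x
  ∨-identityˡ x = absorbʳ (0-least x)

  ∨-identityʳ : ∀ x → x ∨ 0# ≈ x
  ∨-identityʳ x = absorbˡ (0-least x)

  ∨-zeroˡ : ∀ x → 1# ∨ x ≈ 1#
  ∨-zeroˡ x = absorbˡ (≤-top x)

  ∨-zeroʳ : ∀ x → x ∨ 1# ≈ 1#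
  ∨-zeroʳ x = absorbʳ (≤-top x)

  ∨-mono : ∀ {a a′ b b′} → a ≤ a′ → b ≤ b′ → a ∨ b ≤ a′ ∨ b′
  ∨-mono p q = ∨-least (≤-trans p (∨-ub₁ _ _)) (≤-trans q (∨-ub₂ _ _))

  ∧-mono : ∀ {a a′ b b′} → a ≤ a′ → b ≤ b′ → a ∧ b ≤ a′ ∧ b′
  ∧-mono p q = ∧-greatest (≤-trans (∧-lowerˡ _ _) p) (≤-trans (∧-lowerʳ _ _) q)

  ∧-cong : ∀ {a a′ b b′} → a ≈ a′ → b ≈ b′ → a ∧ b ≈ a′ ∧ b′
  ∧-cong p q = antisym (∧-mono (≈⇒≤ p) (≈⇒≤ q)) (∧-mono (≈⇒≤ (≈-sym p)) (≈⇒≤ (≈-sym q)))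

  ∧-zeroˡ : ∀ x → 0# ∧ x ≈ 0#
  ∧-zeroˡ x = antisym (∧-lowerˡ _ _) (0-least _)

  ∧-zeroʳ : ∀ x → x ∧ 0# ≈ 0#
  ∧-zeroʳ x = antisym (∧-lowerʳ _ _) (0-least _)

  ·-≤ʳ : ∀ x y → x · y ≤ y
  ·-≤ʳ x y = ≤-trans (≈⇒≤ (M.comm x y)) (·-≤ˡ y x)

  0-complemented : IsComplemented 0#
  0-complemented = 1# , ∨-identityˡ 1# , ∧-zeroˡ 1#

  1-complemented : IsComplemented 1#
  1-complemented = 0# , ∨-identityʳ 1# , ∧-zeroʳ 1#

  ⋀-lower : ∀ {n} (g : Fin n → Carrier) i → ⋀-fin g ≤ g i
  ⋀-lower g zero    = ∧-lowerˡ _ _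
  ⋀-lower g (suc i) = ≤-trans (∧-lowerʳ _ _) (⋀-lower (g ∘ suc) i)

  ⋀-greatest : ∀ {n} (g : Fin n → Carrier) {z} → (∀ i → z ≤ g i) → z ≤ ⋀-fin g
  ⋀-greatest {zero}  g z≤g = ≤-top _
  ⋀-greatest {suc n} g z≤g = ∧-greatest (z≤g zero) (⋀-greatest (g ∘ suc) (z≤g ∘ suc))

  ⋀-cong : ∀ {n} (g h : Fin n → Carrier) → (∀ i → g i ≈ h i) → ⋀-fin g ≈ ⋀-fin h
  ⋀-cong g h g≈h = antisym
    (⋀-greatest h (λ i → ≤-trans (⋀-lower g i) (≈⇒≤ (g≈h i))))
    (⋀-greatest g (λ i → ≤-trans (⋀-lower h i) (≈⇒≤ (≈-sym (g≈h i)))))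

  ∨ʳ-preserves-⋁ : ∀ b {I : Set} (f : I → Carrier) → ⋁ f ∨ b ≈ b ∨ ⋁ (λ k → f k ∨ b)
  ∨ʳ-preserves-⋁ b f = antisym
    (∨-least (⋁-least f _ (λ k → ≤-trans (∨-ub₁ (f k) b)
                                  (≤-trans (⋁-upper (λ k → f k ∨ b) k) (∨-ub₂ _ _))))
             (∨-ub₁ _ _))
    (∨-least (∨-ub₂ _ _) (⋁-least _ _ (λ k → ∨-mono (⋁-upper f k) ≤-refl)))

  ∨ʳ-preserves-· : ∀ b x y → x · y ∨ b ≈ (x ∨ b) · (y ∨ b) ∨ b
  ∨ʳ-preserves-· b x y = antisym
    (∨-mono (≤-trans (·-monoˡ y (∨-ub₁ x b)) (·-monoʳ _ (∨-ub₁ y b))) ≤-refl)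
    (∨-least (≤-trans (≈⇒≤ (distribʳ-∨ _ x b))
               (∨-least (≤-trans (≈⇒≤ (distribˡ-∨ x y b)) (∨-mono ≤-refl (·-≤ʳ x b)))
                        (≤-trans (·-≤ˡ b _) (∨-ub₂ _ _))))
             (∨-ub₂ _ _))

  module Complemented {e : Carrier} (e-complemented : IsComplemented e) where
    private
      e′ = proj₁ e-complemented

    ≤-split : ∀ z → z ≤ z · e ∨ z · e′
    ≤-split z = ≤-trans (≈⇒≤ (≈-sym (M.identityʳ z)))
      (≤-trans (·-monoʳ z (≈⇒≤ (≈-sym (proj₁ (proj₂ e-complemented)))))
               (≈⇒≤ (distribˡ-∨ z e e′)))

    ·-complement-≤ : ∀ {z} a → z ≤ a ∨ e → z · e′ ≤ a
    ·-complement-≤ a z≤a∨e = ≤-trans (·-monoˡ e′ z≤a∨e)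
      (≤-trans (≈⇒≤ (distribʳ-∨ e′ a e))
               (∨-least (·-≤ˡ a e′) (≤-trans e·e′≤0 (0-least a))))
      where
      e·e′≤0 : e · e′ ≤ 0#
      e·e′≤0 = ≤-trans (∧-greatest (·-≤ˡ e e′) (·-≤ʳ e e′)) (≈⇒≤ (proj₂ (proj₂ e-complemented)))

    ∨-distribʳ-∧ : ∀ a b → (a ∨ e) ∧ (b ∨ e) ≤ (a ∧ b) ∨ e
    ∨-distribʳ-∧ a b = ≤-trans (≤-split _)
      (∨-least (≤-trans (·-≤ʳ _ e) (∨-ub₂ _ _))
               (≤-trans (∧-greatest (·-complement-≤ a (∧-lowerˡ _ _))
                                    (·-complement-≤ b (∧-lowerʳ _ _)))
                        (∨-ub₁ _ _)))

    ∨-distribˡ-∧ : ∀ x d → (x ∨ e) ∧ (x ∨ d) ≤ x ∨ (e ∧ d)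
    ∨-distribˡ-∧ x d = ≤-trans (≤-split _)
      (∨-least ·e≤ (≤-trans (·-complement-≤ x (∧-lowerˡ _ _)) (∨-ub₁ _ _)))
      where
      ·e≤ : ((x ∨ e) ∧ (x ∨ d)) · e ≤ x ∨ (e ∧ d)
      ·e≤ = ≤-trans (·-monoˡ e (∧-lowerʳ _ _))
        (≤-trans (≈⇒≤ (distribʳ-∨ e x d))
                 (∨-mono (·-≤ˡ x e) (∧-greatest (·-≤ʳ d e) (·-≤ˡ d e))))

  ∨-distribˡ-⋀ : ∀ {n} (e : Fin n → Carrier) → (∀ i → IsComplemented (e i)) →
                 ∀ x → ⋀-fin (λ i → x ∨ e i) ≤ x ∨ ⋀-fin e
  ∨-distribˡ-⋀ {zero}  e e-comp x = ∨-ub₂ x 1#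
  ∨-distribˡ-⋀ {suc n} e e-comp x =
    ≤-trans (∧-mono ≤-refl (∨-distribˡ-⋀ (e ∘ suc) (e-comp ∘ suc) x))
            (Complemented.∨-distribˡ-∧ (e-comp zero) x _)

  ∨-distribʳ-⋀ : ∀ {e} → IsComplemented e →
                 ∀ {n} (c : Fin n → Carrier) → ⋀-fin (λ j → c j ∨ e) ≤ ⋀-fin c ∨ e
  ∨-distribʳ-⋀ e-comp {zero}  c = ∨-ub₁ _ _
  ∨-distribʳ-⋀ e-comp {suc n} c =
    ≤-trans (∧-mono ≤-refl (∨-distribʳ-⋀ e-comp (c ∘ suc)))
            (Complemented.∨-distribʳ-∧ e-comp (c zero) _)

≅-sym : ∀ {A B} → A ≅ B → B ≅ A
≅-sym {A} {B} φ = record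
  { to        = from
  ; from      = to
  ; to-cong   = from-cong
  ; from-cong = to-cong
  ; from-to   = to-from
  ; to-from   = from-to
  ; to-⋁      = λ g → A.≈-trans (from-cong (B.⋁-cong _ _ (λ i → B.≈-sym (to-from (g i)))))
                        (A.≈-trans (from-cong (B.≈-sym (to-⋁ (from ∘ g)))) (from-to _))
  ; to-·      = λ x y → A.≈-trans (from-cong (B.·-cong (B.≈-sym (to-from x)) (B.≈-sym (to-from y))))
                          (A.≈-trans (from-cong (B.≈-sym (to-· _ _))) (from-to _))
  ; to-1      = A.≈-trans (from-cong (B.≈-sym to-1)) (from-to _)
  }
  where
  open _≅_ φ
  module A = QuantaleProperties A
  module B = QuantaleProperties B

≅-trans : ∀ {A B C} → A ≅ B → B ≅ C → A ≅ C
≅-trans {A} {B} {C} φ ψ = record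
  { to        = ψ.to ∘ φ.to
  ; from      = φ.from ∘ ψ.from
  ; to-cong   = ψ.to-cong ∘ φ.to-cong
  ; from-cong = φ.from-cong ∘ ψ.from-cong
  ; from-to   = λ x → A.≈-trans (φ.from-cong (ψ.from-to _)) (φ.from-to x)
  ; to-from   = λ x → C.≈-trans (ψ.to-cong (φ.to-from _)) (ψ.to-from x)
  ; to-⋁      = λ f → C.≈-trans (ψ.to-cong (φ.to-⋁ f)) (ψ.to-⋁ _)
  ; to-·      = λ x y → C.≈-trans (ψ.to-cong (φ.to-· x y)) (ψ.to-· _ _)
  ; to-1      = C.≈-trans (ψ.to-cong φ.to-1) ψ.to-1
  }
  where
  module φ = _≅_ φ
  module ψ = _≅_ ψ
  module A = QuantaleProperties A
  module C = QuantaleProperties C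

Π-cong : ∀ {n} {F G : Fin n → Quantale} → (∀ i → F i ≅ G i) → Π F ≅ Π G
Π-cong φ = record
  { to        = λ x i → _≅_.to (φ i) (x i)
  ; from      = λ x i → _≅_.from (φ i) (x i)
  ; to-cong   = λ p i → _≅_.to-cong (φ i) (p i)
  ; from-cong = λ p i → _≅_.from-cong (φ i) (p i)
  ; from-to   = λ x i → _≅_.from-to (φ i) (x i)
  ; to-from   = λ x i → _≅_.to-from (φ i) (x i)
  ; to-⋁      = λ f i → _≅_.to-⋁ (φ i) (λ j → f j i)
  ; to-·      = λ x y i → _≅_.to-· (φ i) (x i) (y i)
  ; to-1      = λ i → _≅_.to-1 (φ i)
  }

module ≅-Monotone {A B : Quantale} (φ : A ≅ B) where
  open _≅_ φ
  private
    module A = Quantale A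
    module B = Quantale B
    module PA = QuantaleProperties A
    module PB = QuantaleProperties B

  to-∨ : ∀ a b → to (a A.∨ b) B.≈ to a B.∨ to b
  to-∨ a b = PB.≈-trans (to-⋁ (A.pair a b))
    (PB.⋁-cong _ _ λ { true → PB.≈-refl ; false → PB.≈-refl })

  to-mono : ∀ {a b} → a A.≤ b → to a B.≤ to b
  to-mono {a} {b} a≤b = PB.≤-trans (PB.∨-ub₁ (to a) (to b))
    (PB.≈⇒≤ (PB.≈-trans (PB.≈-sym (to-∨ a b)) (to-cong (PA.absorbʳ a≤b))))

module ≅-Properties {A B : Quantale} (φ : A ≅ B) where
  open _≅_ φ
  open ≅-Monotone φ public
  private
    module A = Quantale A
    module B = Quantale B
    module PA = QuantaleProperties A
    module PB = QuantaleProperties B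

  from-mono : ∀ {a b} → a B.≤ b → from a A.≤ from b
  from-mono = ≅-Monotone.to-mono (≅-sym φ)

  to-∧ : ∀ a b → to (a A.∧ b) B.≈ to a B.∧ to b
  to-∧ a b = PB.antisym
    (B.∧-greatest (to-mono (A.∧-lowerˡ a b)) (to-mono (A.∧-lowerʳ a b)))
    (PB.≤-trans (PB.≈⇒≤ (PB.≈-sym (to-from _)))
      (to-mono (A.∧-greatest
        (PA.≤-trans (from-mono (B.∧-lowerˡ _ _)) (PA.≈⇒≤ (from-to a)))
        (PA.≤-trans (from-mono (B.∧-lowerʳ _ _)) (PA.≈⇒≤ (from-to b))))))

  to-0 : to A.0# B.≈ B.0#
  to-0 = PB.≈-trans (to-⋁ (λ ())) (PB.⋁-cong _ _ (λ ()))

  to-⋀ : ∀ {n} (g : Fin n → A.Carrier) → to (A.⋀-fin g) B.≈ B.⋀-fin (to ∘ g)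
  to-⋀ {zero}  g = to-1
  to-⋀ {suc n} g = PB.≈-trans (to-∧ _ _) (PB.∧-cong PB.≈-refl (to-⋀ (g ∘ suc)))

  to-complemented : ∀ {a} → A.IsComplemented a → B.IsComplemented (to a)
  to-complemented (a′ , a∨a′≈1 , a∧a′≈0) =
    to a′ ,
    PB.≈-trans (PB.≈-sym (to-∨ _ _)) (PB.≈-trans (to-cong a∨a′≈1) to-1) ,
    PB.≈-trans (PB.≈-sym (to-∧ _ _)) (PB.≈-trans (to-cong a∧a′≈0) to-0)

  upset-cong : ∀ b → [_⟩ {A} b ≅ [_⟩ {B} (to b)
  upset-cong b = record
    { to        = λ x → to (proj₁ x) , to-mono (proj₂ x)
    ; from      = λ y → from (proj₁ y) ,
                        PA.≤-trans (PA.≈⇒≤ (PA.≈-sym (from-to b))) (from-mono (proj₂ y))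
    ; to-cong   = to-cong
    ; from-cong = from-cong
    ; from-to   = from-to ∘ proj₁
    ; to-from   = to-from ∘ proj₁
    ; to-⋁      = λ f → PB.≈-trans (to-∨ _ _) (PB.∨-cong PB.≈-refl (to-⋁ (proj₁ ∘ f)))
    ; to-·      = λ x y → PB.≈-trans (to-∨ _ _) (PB.∨-cong (to-· _ _) PB.≈-refl)
    ; to-1      = to-1
    }

module Decomposition (A : Quantale) where
  open Quantale A
  open QuantaleProperties A

  IsDecomposition : ∀ {n} → (Fin n → Quantale) → (Fin n → Carrier) → Set₁
  IsDecomposition As e =
    (∀ i → IsComplemented (e i))
    × ⋀-fin e ≈ 0#
    × (∀ i j → i ≢ j → e i ∨ e j ≈ 1#)
    × (∀ i → As i ≅ [_⟩ {A} (e i))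

  ≅Π-upsets : ∀ {n} {e : Fin n → Carrier} → (∀ i → IsComplemented (e i)) → ⋀-fin e ≈ 0# →
              (∀ i j → i ≢ j → e i ∨ e j ≈ 1#) → A ≅ Π (λ i → [_⟩ {A} (e i))
  ≅Π-upsets {n} {e} e-comp ⋀e≈0 comaximal = record
    { to        = λ x i → x ∨ e i , ∨-ub₂ x (e i)
    ; from      = λ y → ⋀-fin (λ i → proj₁ (y i))
    ; to-cong   = λ p i → ∨-cong p ≈-refl
    ; from-cong = ⋀-cong _ _
    ; from-to   = λ x → antisym
        (≤-trans (∨-distribˡ-⋀ e e-comp x)
                 (≤-trans (∨-mono ≤-refl (≈⇒≤ ⋀e≈0)) (≈⇒≤ (∨-identityʳ x))))
        (⋀-greatest _ (λ i → ∨-ub₁ x (e i)))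
    ; to-from   = λ y i → antisym
        (∨-least (⋀-lower _ i) (proj₂ (y i)))
        (≤-trans (⋀-greatest _ (component-≤ y i)) (∨-distribʳ-⋀ (e-comp i) (λ j → proj₁ (y j))))
    ; to-⋁      = λ f i → ∨ʳ-preserves-⋁ (e i) f
    ; to-·      = λ x y i → ∨ʳ-preserves-· (e i) x y
    ; to-1      = λ i → ∨-zeroˡ (e i)
    }
    where
    -- For j ≢ i the right-hand side is already 1, as it lies above e j ∨ e i.
    component-≤ : (y : ∀ i → Σ[ x ∈ Carrier ] e i ≤ x) → ∀ i j → proj₁ (y i) ≤ proj₁ (y j) ∨ e i
    component-≤ y i j with i ≟ j
    ... | yes refl = ∨-ub₁ _ _
    ... | no i≢j = ≤-trans (≤-top _)
      (≤-trans (≈⇒≤ (≈-sym (comaximal j i (i≢j ∘ sym)))) (∨-mono (proj₂ (y j)) ≤-refl))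

  decomposition⇒≅Π : ∀ {n} {As : Fin n → Quantale} {e} → IsDecomposition As e → A ≅ Π As
  decomposition⇒≅Π (e-comp , ⋀e≈0 , comaximal , As≅upset) =
    ≅-trans (≅Π-upsets e-comp ⋀e≈0 comaximal) (Π-cong (λ i → ≅-sym (As≅upset i)))

open Decomposition using (IsDecomposition)

decomposition-transport : ∀ {A B n} {As : Fin n → Quantale} {e} (φ : A ≅ B) →
                          IsDecomposition A As e → IsDecomposition B As (_≅_.to φ ∘ e)
decomposition-transport {A} {B} {e = e} φ (e-comp , ⋀e≈0 , comaximal , As≅upset) =
  to-complemented ∘ e-comp ,
  PB.≈-trans (PB.≈-sym (to-⋀ e)) (PB.≈-trans (to-cong ⋀e≈0) to-0) ,
  (λ i j i≢j → PB.≈-trans (PB.≈-sym (to-∨ _ _)) (PB.≈-trans (to-cong (comaximal i j i≢j)) to-1)) ,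
  λ i → ≅-trans (As≅upset i) (upset-cong (e i))
  where
  open _≅_ φ
  open ≅-Properties φ
  module PB = QuantaleProperties B

module Product {n} (As : Fin n → Quantale) where
  private
    module Q (j : Fin n) = Quantale (As j)
    module P (j : Fin n) = QuantaleProperties (As j)
    module ΠA = Quantale (Π As)
    module PΠ = QuantaleProperties (Π As)

  module _ (j : Fin n) where
    open Quantale (As j)
    open QuantaleProperties (As j)

    Π-∨ : ∀ x y → (x ΠA.∨ y) j ≈ x j ∨ y j
    Π-∨ x y = ⋁-cong _ _ λ { true → ≈-refl ; false → ≈-refl }

    Π-0 : ΠA.0# j ≈ 0#
    Π-0 = ⋁-cong _ _ (λ ())

  Π-complemented : ∀ {x} → (∀ j → Q.IsComplemented j (x j)) → ΠA.IsComplemented x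
  Π-complemented x-comp =
    (λ j → proj₁ (x-comp j)) ,
    (λ j → P.≈-trans j (Π-∨ j _ _) (proj₁ (proj₂ (x-comp j)))) ,
    (λ j → P.≈-trans j (proj₂ (proj₂ (x-comp j))) (P.≈-sym j (Π-0 j)))

  ones[_≔_] : (i : Fin n) → Q.Carrier i → ΠA.Carrier
  ones[ i ≔ a ] j with i ≟ j
  ... | yes refl = a
  ... | no _     = Q.1# j

  zeroAt : Fin n → ΠA.Carrier
  zeroAt i = ones[ i ≔ Q.0# i ]

  ones-elim : ∀ i a (P : ∀ j → Q.Carrier j → Set) →
              P i a → (∀ j → i ≢ j → P j (Q.1# j)) → ∀ j → P j (ones[ i ≔ a ] j)
  ones-elim i a P Pa P1 j with i ≟ j
  ... | yes refl = Pa
  ... | no i≢j   = P1 j i≢j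

  module _ (i : Fin n) where
    open Quantale (As i)
    open QuantaleProperties (As i)

    ones-at : ∀ a → ones[ i ≔ a ] i ≈ a
    ones-at a with i ≟ i
    ... | yes refl = ≈-refl
    ... | no i≢i   = ⊥-elim (i≢i refl)

    ones-mono : ∀ {a b} → a ≤ b → ones[ i ≔ a ] ΠA.≤ ones[ i ≔ b ]
    ones-mono a≤b j with i ≟ j
    ... | yes refl = a≤b
    ... | no _     = P.≤-refl j

    ones-cong : ∀ {a b} → a ≈ b → ones[ i ≔ a ] ΠA.≈ ones[ i ≔ b ]
    ones-cong a≈b = PΠ.antisym (ones-mono (≈⇒≤ a≈b)) (ones-mono (≈⇒≤ (≈-sym a≈b)))

  ones-≢ : ∀ {i j} a → i ≢ j → Q._≈_ j (ones[ i ≔ a ] j) (Q.1# j)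
  ones-≢ {i} {j} a i≢j with i ≟ j
  ... | yes i≡j = ⊥-elim (i≢j i≡j)
  ... | no _    = P.≈-refl j

  module _ (i j : Fin n) where
    open Quantale (As j)
    open QuantaleProperties (As j)

    ones-1 : ones[ i ≔ Q.1# i ] j ≈ 1#
    ones-1 with i ≟ j
    ... | yes refl = ≈-refl
    ... | no _     = ≈-refl

    ones-⋁ : ∀ {I : Set} (f : I → Q.Carrier i) →
             ones[ i ≔ Q.⋁ i f ] j ≈ zeroAt i j ∨ ⋁ (λ k → ones[ i ≔ f k ] j)
    ones-⋁ f with i ≟ j
    ... | yes refl = ≈-sym (∨-identityˡ _)
    ... | no _     = ≈-sym (∨-zeroˡ _)

    ones-· : ∀ a b → ones[ i ≔ Q._·_ i a b ] j ≈
                     ones[ i ≔ a ] j · ones[ i ≔ b ] j ∨ zeroAt i j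
    ones-· a b with i ≟ j
    ... | yes refl = ≈-sym (∨-identityʳ _)
    ... | no _     = ≈-sym (∨-zeroʳ _)

    ones-above : ∀ {x} → zeroAt i ΠA.≤ x → ones[ i ≔ x i ] j ≈ x j
    ones-above zeroAt≤x with i ≟ j
    ... | yes refl = ≈-refl
    ... | no i≢j   = antisym (≤-trans (≈⇒≤ (≈-sym (ones-≢ _ i≢j))) (zeroAt≤x j)) (≤-top _)

  factor≅upset : ∀ i → As i ≅ [_⟩ {Π As} (zeroAt i)
  factor≅upset i = record
    { to        = λ a → ones[ i ≔ a ] , ones-mono i (P.0-least i a)
    ; from      = λ x → proj₁ x i
    ; to-cong   = ones-cong i
    ; from-cong = λ p → p i
    ; from-to   = ones-at i
    ; to-from   = λ x j → ones-above i j (proj₂ x)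
    ; to-⋁      = λ f j → P.≈-trans j (ones-⋁ i j f) (P.≈-sym j (Π-∨ j _ _))
    ; to-·      = λ a b j → P.≈-trans j (ones-· i j a b) (P.≈-sym j (Π-∨ j _ _))
    ; to-1      = ones-1 i
    }

  zeroAt-complemented : ∀ i → ΠA.IsComplemented (zeroAt i)
  zeroAt-complemented i = Π-complemented
    (ones-elim i _ (λ j → Q.IsComplemented j)
      (P.0-complemented i) (λ j _ → P.1-complemented j))

  ⋀-zeroAt : ΠA.⋀-fin zeroAt ΠA.≈ ΠA.0#
  ⋀-zeroAt = PΠ.antisym
    (λ j → P.≤-trans j (PΠ.⋀-lower zeroAt j j)
             (P.≤-trans j (P.≈⇒≤ j (ones-at j _)) (P.0-least j _)))
    (PΠ.0-least _)

  zeroAt-comaximal : ∀ i j → i ≢ j → zeroAt i ΠA.∨ zeroAt j ΠA.≈ ΠA.1#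
  zeroAt-comaximal i j i≢j k = P.≈-trans k (Π-∨ k _ _)
    (ones-elim i _ (λ k x → Q._≈_ k (Q._∨_ k x (zeroAt j k)) (Q.1# k))
      (P.≈-trans i (P.∨-cong i (P.≈-refl i) (ones-≢ _ (i≢j ∘ sym))) (P.∨-zeroʳ i _))
      (λ k _ → P.∨-zeroˡ k _) k)

  Π-decomposition : IsDecomposition (Π As) As zeroAt
  Π-decomposition = zeroAt-complemented , ⋀-zeroAt , zeroAt-comaximal , factor≅upset

open Quantale using (Carrier; IsCoherent; IsComplemented; ⋀-fin; _≈_; _∨_; 0#; 1#)

proposition7p4 : (A : Quantale) (n : ℕ) (As : Fin n → Quantale) →
    IsCoherent A → (∀ i → IsCoherent (As i)) →
    (A ≅ Π As) ⇔
    (Σ[ e ∈ (Fin n → Carrier A) ]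
      ((∀ i → IsComplemented A (e i))
      × _≈_ A (⋀-fin A e) (0# A)
      × (∀ i j → i ≢ j → _≈_ A (_∨_ A (e i) (e j)) (1# A))
      × (∀ i → As i ≅ [_⟩ {A} (e i))))
proposition7p4 A n As _ _ = mk⇔
  (λ φ → _≅_.from φ ∘ Product.zeroAt As ,
         decomposition-transport (≅-sym φ) (Product.Π-decomposition As))
  (λ { (_ , decomposition) → Decomposition.decomposition⇒≅Π A decomposition })
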